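{- Let $\mathbf d=(\mathbf a,\mathbf b)\in\mathbb Z^{N\times2}$ with $\sum_n a_n=\sum_n b_n+1$, let $i\ne j$ with $a_i,a_j\ge1$, and put $\mathbf d_{ -i}=(\mathbf a-\mathbf e_i,\mathbf b)$, $\mathbf d_{ -j}=(\mathbf a-\mathbf e_j,\mathbf b)$. Define $X_{0_i}=\{(\mathbf a-a_i\mathbf e_i-\mathbf e_j,\mathbf b-\mathbf s):\mathbf s\in\{0,1\}^N,\ \sum_n s_n=a_i\}$, $X_{1_i}=\{(\mathbf a-a_i\mathbf e_i-\mathbf e_j,\mathbf b-\mathbf s):\mathbf s\in\{0,1,2\}^N$ with exactly one entry equal to $2$ and exactly $a_i-2$ entries equal to $1\}$, and $X_{0_j},X_{1_j}$ analogously with $(\mathbf a-\mathbf e_i-a_j\mathbf e_j)$ in place of $(\mathbf a-a_i\mathbf e_i-\mathbf e_j)$ and $a_j$ in place of $a_i$. Provided $\|G_{\mathbf d_{ -j}}\|$, $\|G_{X_{0_i}}\|$ and $\|G_{X_{0_j}}\|$ are nonzero, $$\frac{\|G_{\mathbf d_{ -i}}\|}{\|G_{\mathbf d_{ -j}}\|}=\frac{a_i}{a_j}\left(\frac{1+\|G_{X_{1_i}}\|/(a_i\|G_{X_{0_i}}\|)}{1+\|G_{X_{1_j}}\|/(a_j\|G_{X_{0_j}}\|)}\right).$$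
   Context: $\|G_{\mathbf d}\|$ is the number of directed graphs on $\{1,\dots,N\}$ (each ordered pair, including loops, carrying at most one edge) with in-degree sequence $\mathbf a$ and out-degree sequence $\mathbf b$; it is $0$ if $\mathbf d$ has a negative entry. For a set $X$ of bidegree sequences, $\|G_X\|=\sum_{\mathbf r\in X}\|G_{\mathbf r}\|$. $\mathbf e_k$ is the $k$-th standard unit vector. -}

module Defs where

open import Data.Nat as ℕ using (ℕ; zero; suc)
open import Data.Integer as ℤ using (ℤ; +_)
open import Data.Fin as Fin using (Fin)
open import Data.Bool using (Bool; true; false; if_then_else_; _∧_)
open import Data.List using (List; []; _∷_; [_]; map; concatMap; foldr; allFin)
open import Data.Nat.ListAction using (sum)
open import Data.Vec as Vec using (Vec; []; _∷_; lookup)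
open import Relation.Nullary.Decidable using (⌊_⌋)

allVecs : ∀ {A : Set} → List A → (n : ℕ) → List (Vec A n)
allVecs xs zero    = [ [] ]
allVecs xs (suc n) = concatMap (λ x → map (x ∷_) (allVecs xs n)) xs

allF : ∀ {N} → (Fin N → Bool) → Bool
allF {N} p = foldr (λ k r → p k ∧ r) true (allFin N)

sumZ : ∀ {N} → (Fin N → ℤ) → ℤ
sumZ {N} v = foldr (λ k r → v k ℤ.+ r) (+ 0) (allFin N)

countF : ∀ {N} → (Fin N → Bool) → ℕ
countF {N} p = sum (map (λ k → if p k then 1 else 0) (allFin N))

unit : ∀ {N} → Fin N → Fin N → ℤ
unit k n = if ⌊ k Fin.≟ n ⌋ then + 1 else + 0

-- A directed graph on Fin N (loops allowed, at most one edge per ordered pair):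
-- adjacency matrix M, edge u → v iff lookup (lookup M u) v ≡ true.
Digraph : ℕ → Set
Digraph N = Vec (Vec Bool N) N

edge : ∀ {N} → Digraph N → Fin N → Fin N → Bool
edge M u v = lookup (lookup M u) v

indeg : ∀ {N} → Digraph N → Fin N → ℕ
indeg M v = countF (λ u → edge M u v)

outdeg : ∀ {N} → Digraph N → Fin N → ℕ
outdeg M u = countF (λ v → edge M u v)

allDigraphs : (N : ℕ) → List (Digraph N)
allDigraphs N = allVecs (allVecs (true ∷ false ∷ []) N) N

realizes : ∀ {N} → (a b : Fin N → ℤ) → Digraph N → Bool
realizes a b M = allF (λ v → ⌊ + indeg M v ℤ.≟ a v ⌋) ∧ allF (λ u → ⌊ + outdeg M u ℤ.≟ b u ⌋)

-- ‖G_d‖ for d = (a , b): number of digraphs with in-degrees a and out-degrees b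
-- (automatically 0 if some entry is negative).
G : ∀ {N} → (a b : Fin N → ℤ) → ℕ
G {N} a b = sum (map (λ M → if realizes a b M then 1 else 0) (allDigraphs N))

_-ᵛ_ : ∀ {N} → (Fin N → ℤ) → (Fin N → ℤ) → (Fin N → ℤ)
(u -ᵛ v) k = u k ℤ.- v k

_·ᵛ_ : ∀ {N} → ℤ → (Fin N → ℤ) → (Fin N → ℤ)
(c ·ᵛ v) k = c ℤ.* v k

-- Sum of ‖G_(a', b - s)‖ over all s ∈ vals^N satisfying cond s.
-- (Distinct s give distinct bidegree sequences, so this is ‖G_X‖ for the
-- set X = {(a', b - s) : s ∈ vals^N, cond s}.)
sumOverS : ∀ {N} → List ℤ → ((Fin N → ℤ) → Bool) → (a' b : Fin N → ℤ) → ℕ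
sumOverS {N} vals cond a' b =
  sum (map (λ s → if cond (lookup s) then G a' (b -ᵛ lookup s) else 0) (allVecs vals N))

shiftA : ∀ {N} → (a : Fin N → ℤ) → (i j : Fin N) → Fin N → ℤ
shiftA a i j = (a -ᵛ (a i ·ᵛ unit i)) -ᵛ unit j

X0 : ∀ {N} → (a b : Fin N → ℤ) → (i j : Fin N) → ℕ
X0 a b i j = sumOverS (+ 0 ∷ + 1 ∷ []) (λ s → ⌊ sumZ s ℤ.≟ a i ⌋) (shiftA a i j) b

X1 : ∀ {N} → (a b : Fin N → ℤ) → (i j : Fin N) → ℕ
X1 a b i j = sumOverS (+ 0 ∷ + 1 ∷ + 2 ∷ [])
  (λ s → ⌊ countF (λ k → ⌊ s k ℤ.≟ + 2 ⌋) ℕ.≟ 1 ⌋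
       ∧ ⌊ + countF (λ k → ⌊ s k ℤ.≟ + 1 ⌋) ℤ.≟ a i ℤ.- + 2 ⌋)
  (shiftA a i j) b

-- Two counting identities give the corollary.  First, sorting the digraphs with
-- bidegree (c′, b) by their i-th column s shows that they are in bijection with
-- the digraphs of bidegree (c, b - s), where c′ and c differ only in that c i = 0
-- and c′ i = Σ s; this yields X₀ᵢ = ‖G_{d₋ⱼ}‖.  Second, applying the same column
-- removal to Q = Σ_u ‖G_{(a - eᵢ - eⱼ, b - e_u)}‖ writes Q as a sum over pairs
-- (s, u) with s ∈ {0,1}^N, |s| = aᵢ - 1, of terms depending only on s + e_u.
-- A 0/1 vector with aᵢ ones arises from aᵢ such pairs, a vector with one 2 and
-- aᵢ - 2 ones from exactly one, so Q = aᵢ X₀ᵢ + X₁ᵢ.  As Q is symmetric in i and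
-- j, both sides of the identity equal ‖G_{d₋ᵢ}‖ ‖G_{d₋ⱼ}‖ aᵢ aⱼ Q.
module Submission where

open import Defs
open import Data.Bool using (Bool; true; false; if_then_else_; _∧_; not; T)
open import Data.Bool.Properties using (T-∧; ∧-zeroʳ; if-cong; if-cong-then)
open import Data.Empty using (⊥-elim)
open import Data.Fin as Fin using (Fin; zero; suc)
import Data.Fin.Properties as Finₚ
open import Data.Integer as ℤ using (ℤ; +_)
import Data.Integer.Properties as ℤₚ
open import Data.Integer.Tactic.RingSolver using (solve-∀)
open import Data.List using (List; []; _∷_; _++_; map; concatMap; foldr; allFin)
open import Data.List.Properties using (map-cong; map-∘; map-++; map-tabulate; foldr-map)
open import Data.Nat as ℕ using (ℕ; zero; suc)
import Data.Nat.Properties as ℕₚ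
import Data.Nat.Tactic.RingSolver as ℕ-Solver
open import Data.Nat.ListAction using (sum)
open import Data.Nat.ListAction.Properties using (sum-++)
open import Data.Product using (_×_; _,_; proj₁; ∃)
open import Data.Sum using (_⊎_; inj₁; inj₂)
open import Data.Vec as Vec using (Vec; []; _∷_; lookup; _[_]≔_; updateAt)
open import Data.Vec.Properties using (lookup-map; lookup-zipWith; lookup∘update; lookup∘update′; lookup∘updateAt; lookup∘updateAt′)
open import Function using (_∘_; id; _⇔_; mk⇔; Equivalence)
open import Relation.Nullary using (Dec; yes; no)
open import Relation.Nullary.Decidable using (⌊_⌋; isYes≗does; does-⇔; toWitness; fromWitness)
open import Relation.Binary.PropositionalEquality

open Equivalence using (to; from)

-- ℕ arithmetic is opened only inside this module, so that the integer operators
-- of the statement can be opened unqualified after it.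
module Counting where
  open import Data.Nat using (_+_; _*_)

  private variable
    A B : Set
    n : ℕ

  indicator : Bool → ℕ
  indicator b = if b then 1 else 0

  if-indicator : (d r : Bool) → (if d then indicator r else 0) ≡ indicator (d ∧ r)
  if-indicator true  r = refl
  if-indicator false r = refl

  T-injective : {x y : Bool} → T x ⇔ T y → x ≡ y
  T-injective {true}  {true}  _ = refl
  T-injective {true}  {false} h = ⊥-elim (to h _)
  T-injective {false} {true}  h = ⊥-elim (from h _)
  T-injective {false} {false} _ = refl

  ⌊⌋-cong : {P Q : Set} → P ⇔ Q → (p? : Dec P) (q? : Dec Q) → ⌊ p? ⌋ ≡ ⌊ q? ⌋
  ⌊⌋-cong P⇔Q p? q? = trans (isYes≗does p?) (trans (does-⇔ P⇔Q p? q?) (sym (isYes≗does q?)))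

  +≡⇔≡- : (x y z : ℤ) → x ℤ.+ y ≡ z ⇔ y ≡ z ℤ.- x
  +≡⇔≡- x y z = mk⇔ (λ e → trans (sym (cancel x y)) (cong (ℤ._- x) e)) (λ e → trans (cong (λ w → x ℤ.+ w) e) (cancel′ x z))
    where
    cancel : ∀ x y → (x ℤ.+ y) ℤ.- x ≡ y
    cancel = solve-∀
    cancel′ : ∀ x z → x ℤ.+ (z ℤ.- x) ≡ z
    cancel′ = solve-∀

  ⌊+≟⌋-shift : (x y z : ℤ) → ⌊ x ℤ.+ y ℤ.≟ z ⌋ ≡ ⌊ y ℤ.≟ z ℤ.- x ⌋
  ⌊+≟⌋-shift x y z = ⌊⌋-cong (+≡⇔≡- x y z) _ _

  ∑ : List A → (A → ℕ) → ℕ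
  ∑ xs f = sum (map f xs)

  infix 5 ∑
  syntax ∑ xs (λ x → e) = ∑[ x ∈ xs ] e

  ∑-cong : (xs : List A) {f g : A → ℕ} → (∀ x → f x ≡ g x) → ∑ xs f ≡ ∑ xs g
  ∑-cong xs f≗g = cong sum (map-cong f≗g xs)

  ∑-zero : (xs : List A) → ∑[ x ∈ xs ] 0 ≡ 0
  ∑-zero []       = refl
  ∑-zero (x ∷ xs) = ∑-zero xs

  ∑-distrib-+ : (xs : List A) (f g : A → ℕ) → ∑[ x ∈ xs ] (f x + g x) ≡ ∑ xs f + ∑ xs g
  ∑-distrib-+ []       f g = refl
  ∑-distrib-+ (x ∷ xs) f g =
    trans (cong (_+_ (f x + g x)) (∑-distrib-+ xs f g)) (interchange (f x) (g x) (∑ xs f) (∑ xs g))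
    where
    interchange : ∀ a b c d → a + b + (c + d) ≡ a + c + (b + d)
    interchange = ℕ-Solver.solve-∀

  *-distribˡ-∑ : (xs : List A) (c : ℕ) (f : A → ℕ) → c * ∑ xs f ≡ ∑[ x ∈ xs ] (c * f x)
  *-distribˡ-∑ []       c f = ℕₚ.*-zeroʳ c
  *-distribˡ-∑ (x ∷ xs) c f =
    trans (ℕₚ.*-distribˡ-+ c (f x) (∑ xs f)) (cong (_+_ (c * f x)) (*-distribˡ-∑ xs c f))

  ∑-comm : (xs : List A) (ys : List B) (f : A → B → ℕ) →
    ∑[ x ∈ xs ] ∑[ y ∈ ys ] f x y ≡ ∑[ y ∈ ys ] ∑[ x ∈ xs ] f x y
  ∑-comm []       ys f = sym (∑-zero ys)
  ∑-comm (x ∷ xs) ys f =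
    trans (cong (_+_ (∑ ys (f x))) (∑-comm xs ys f)) (sym (∑-distrib-+ ys (f x) (λ y → ∑[ x ∈ xs ] f x y)))

  ∑-if : (d : Bool) (xs : List A) (f : A → ℕ) → (if d then ∑ xs f else 0) ≡ ∑[ x ∈ xs ] (if d then f x else 0)
  ∑-if true  xs f = refl
  ∑-if false xs f = sym (∑-zero xs)

  ∑-map : (g : B → A) (xs : List B) (f : A → ℕ) → ∑ (map g xs) f ≡ ∑ xs (f ∘ g)
  ∑-map g xs f = cong sum (sym (map-∘ xs))

  ∑-concatMap : (g : B → List A) (xs : List B) (f : A → ℕ) → ∑ (concatMap g xs) f ≡ ∑[ x ∈ xs ] ∑ (g x) f
  ∑-concatMap g []       f = refl
  ∑-concatMap g (x ∷ xs) f = begin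
    sum (map f (g x ++ concatMap g xs))         ≡⟨ cong sum (map-++ f (g x) (concatMap g xs)) ⟩
    sum (map f (g x) ++ map f (concatMap g xs)) ≡⟨ sum-++ (map f (g x)) _ ⟩
    ∑ (g x) f + ∑ (concatMap g xs) f            ≡⟨ cong (_+_ (∑ (g x) f)) (∑-concatMap g xs f) ⟩
    ∑ (g x) f + (∑[ y ∈ xs ] ∑ (g y) f)         ∎
    where open ≡-Reasoning

  ∑-allFin-suc : (f : Fin (suc n) → ℕ) → ∑ (allFin (suc n)) f ≡ f zero + ∑ (allFin n) (f ∘ suc)
  ∑-allFin-suc f = cong (_+_ (f zero)) (cong sum (trans (map-tabulate suc f) (sym (map-tabulate id (f ∘ suc)))))

  ∑-allVecs-suc : (xs : List A) (n : ℕ) (f : Vec A (suc n) → ℕ) →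
    ∑ (allVecs xs (suc n)) f ≡ ∑[ x ∈ xs ] ∑[ v ∈ allVecs xs n ] f (x ∷ v)
  ∑-allVecs-suc xs n f =
    trans (∑-concatMap _ xs f) (∑-cong xs (λ x → ∑-map (x ∷_) (allVecs xs n) f))

  ∑-allVecs-map : (g : B → A) (xs : List B) (n : ℕ) (f : Vec A n → ℕ) →
    ∑ (allVecs (map g xs) n) f ≡ ∑ (allVecs xs n) (f ∘ Vec.map g)
  ∑-allVecs-map g xs zero    f = refl
  ∑-allVecs-map g xs (suc n) f = begin
    ∑ (allVecs (map g xs) (suc n)) f                         ≡⟨ ∑-allVecs-suc (map g xs) n f ⟩
    ∑[ y ∈ map g xs ] ∑[ v ∈ allVecs (map g xs) n ] f (y ∷ v) ≡⟨ ∑-map g xs _ ⟩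
    ∑[ x ∈ xs ] ∑[ v ∈ allVecs (map g xs) n ] f (g x ∷ v)     ≡⟨ ∑-cong xs (λ x → ∑-allVecs-map g xs n (f ∘ (g x ∷_))) ⟩
    ∑[ x ∈ xs ] ∑[ v ∈ allVecs xs n ] f (g x ∷ Vec.map g v)   ≡⟨ sym (∑-allVecs-suc xs n _) ⟩
    ∑ (allVecs xs (suc n)) (f ∘ Vec.map g)                   ∎
    where open ≡-Reasoning

  foldr-allFin-suc : (f : Fin (suc n) → B → B) (e : B) →
    foldr f e (allFin (suc n)) ≡ f zero (foldr (f ∘ suc) e (allFin n))
  foldr-allFin-suc {n} f e =
    cong (f zero) (trans (cong (foldr f e) (sym (map-tabulate id suc))) (foldr-map f suc e (allFin n)))

  countF-suc : (p : Fin (suc n) → Bool) → countF p ≡ indicator (p zero) + countF (p ∘ suc)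
  countF-suc p = ∑-allFin-suc (indicator ∘ p)

  countF-cong : {p q : Fin n → Bool} → (∀ k → p k ≡ q k) → countF p ≡ countF q
  countF-cong {n} p≗q = ∑-cong (allFin n) (cong indicator ∘ p≗q)

  countF-false : (n : ℕ) → countF {n} (λ _ → false) ≡ 0
  countF-false n = ∑-zero (allFin n)

  countF≢0 : (p : Fin n → Bool) (u : Fin n) → p u ≡ true → countF p ≢ 0
  countF≢0 {suc n} p zero    pᵤ e
    with () ← trans (cong indicator (sym pᵤ)) (ℕₚ.m+n≡0⇒m≡0 _ (trans (sym (countF-suc p)) e))
  countF≢0 {suc n} p (suc u) pᵤ e =
    countF≢0 (p ∘ suc) u pᵤ (ℕₚ.m+n≡0⇒n≡0 (indicator (p zero)) (trans (sym (countF-suc p)) e))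

  countF-update : (i : Fin n) (p q : Fin n → Bool) → p i ≡ false → (∀ v → v ≢ i → q v ≡ p v) →
    countF q ≡ indicator (q i) + countF p
  countF-update {suc n} zero p q pᵢ q≗p = begin
    countF q
      ≡⟨ countF-suc q ⟩
    indicator (q zero) + countF (q ∘ suc)
      ≡⟨ cong (_+_ (indicator (q zero))) (countF-cong (λ v → q≗p (suc v) (λ ()))) ⟩
    indicator (q zero) + countF (p ∘ suc)
      ≡⟨ cong (λ x → indicator (q zero) + (indicator x + countF (p ∘ suc))) (sym pᵢ) ⟩
    indicator (q zero) + (indicator (p zero) + countF (p ∘ suc))
      ≡⟨ cong (_+_ (indicator (q zero))) (sym (countF-suc p)) ⟩
    indicator (q zero) + countF p ∎
    where open ≡-Reasoning
  countF-update {suc n} (suc i) p q pᵢ q≗p = begin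
    countF q
      ≡⟨ countF-suc q ⟩
    indicator (q zero) + countF (q ∘ suc)
      ≡⟨ cong₂ _+_ (cong indicator (q≗p zero (λ ())))
                   (countF-update i (p ∘ suc) (q ∘ suc) pᵢ (λ v v≢i → q≗p (suc v) (v≢i ∘ Finₚ.suc-injective))) ⟩
    indicator (p zero) + (indicator (q (suc i)) + countF (p ∘ suc))
      ≡⟨ left-comm (indicator (p zero)) (indicator (q (suc i))) (countF (p ∘ suc)) ⟩
    indicator (q (suc i)) + (indicator (p zero) + countF (p ∘ suc))
      ≡⟨ cong (_+_ (indicator (q (suc i)))) (sym (countF-suc p)) ⟩
    indicator (q (suc i)) + countF p ∎
    where
    open ≡-Reasoning
    left-comm : ∀ a b c → a + (b + c) ≡ b + (a + c)
    left-comm = ℕ-Solver.solve-∀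

  sumZ-suc : (v : Fin (suc n) → ℤ) → sumZ v ≡ v zero ℤ.+ sumZ (v ∘ suc)
  sumZ-suc v = foldr-allFin-suc (λ k r → v k ℤ.+ r) (+ 0)

  toℤ : Bool → ℤ
  toℤ b = + indicator b

  sumZ-map-toℤ : (σ : Vec Bool n) → sumZ (lookup (Vec.map toℤ σ)) ≡ + countF (lookup σ)
  sumZ-map-toℤ []      = refl
  sumZ-map-toℤ (x ∷ σ) = begin
    sumZ (lookup (Vec.map toℤ (x ∷ σ))) ≡⟨ sumZ-suc (lookup (Vec.map toℤ (x ∷ σ))) ⟩
    toℤ x ℤ.+ sumZ (lookup (Vec.map toℤ σ)) ≡⟨ cong (ℤ._+_ (toℤ x)) (sumZ-map-toℤ σ) ⟩
    + (indicator x + countF (lookup σ))     ≡⟨ cong +_ (sym (countF-suc (lookup (x ∷ σ)))) ⟩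
    + countF (lookup (x ∷ σ))               ∎
    where open ≡-Reasoning

  allF-suc : (p : Fin (suc n) → Bool) → allF p ≡ p zero ∧ allF (p ∘ suc)
  allF-suc p = foldr-allFin-suc (λ k r → p k ∧ r) true

  T-allF : (p : Fin n → Bool) → T (allF p) ⇔ (∀ k → T (p k))
  T-allF {zero}  p = mk⇔ (λ _ ()) _
  T-allF {suc n} p = mk⇔
    (λ t → let (t₀ , tₛ) = to T-∧ (subst T (allF-suc p) t) in
           λ { zero → t₀ ; (suc k) → to (T-allF (p ∘ suc)) tₛ k })
    (λ h → subst T (sym (allF-suc p)) (from T-∧ (h zero , from (T-allF (p ∘ suc)) (h ∘ suc))))

  HasDegrees : {N : ℕ} (a b : Fin N → ℤ) → Digraph N → Set
  HasDegrees a b M = (∀ v → + indeg M v ≡ a v) × (∀ u → + outdeg M u ≡ b u)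

  T-realizes : {N : ℕ} (a b : Fin N → ℤ) (M : Digraph N) → T (realizes a b M) ⇔ HasDegrees a b M
  T-realizes a b M = mk⇔
    (λ t → let (tᵢₙ , tₒᵤₜ) = to T-∧ t in
           (λ v → toWitness (to (T-allF inOk) tᵢₙ v)) , (λ u → toWitness (to (T-allF outOk) tₒᵤₜ u)))
    (λ (hᵢₙ , hₒᵤₜ) → from T-∧ (from (T-allF inOk) (fromWitness ∘ hᵢₙ) , from (T-allF outOk) (fromWitness ∘ hₒᵤₜ)))
    where
    inOk outOk : Fin _ → Bool
    inOk  v = ⌊ + indeg M v ℤ.≟ a v ⌋
    outOk u = ⌊ + outdeg M u ℤ.≟ b u ⌋

  realizes-transport : {N : ℕ} {a a′ b b′ : Fin N → ℤ} (M : Digraph N) →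
    (∀ v → a v ≡ a′ v) → (∀ u → b u ≡ b′ u) → T (realizes a b M) → T (realizes a′ b′ M)
  realizes-transport {a = a} {a′} {b} {b′} M a≗a′ b≗b′ t =
    let (hᵢₙ , hₒᵤₜ) = to (T-realizes a b M) t in
    from (T-realizes a′ b′ M) ((λ v → trans (hᵢₙ v) (a≗a′ v)) , (λ u → trans (hₒᵤₜ u) (b≗b′ u)))

  G-cong : {N : ℕ} {a a′ b b′ : Fin N → ℤ} → (∀ v → a v ≡ a′ v) → (∀ u → b u ≡ b′ u) → G a b ≡ G a′ b′
  G-cong {N} a≗a′ b≗b′ = ∑-cong (allDigraphs N) (λ M → cong indicator (T-injective (mk⇔
    (realizes-transport M a≗a′ b≗b′) (realizes-transport M (sym ∘ a≗a′) (sym ∘ b≗b′)))))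

  -- Splitting a digraph into one column and the rest

  -- bits lists false first, so that Vec.map toℤ turns allVecs bits into allVecs (+ 0 ∷ + 1 ∷ []).
  bools bits : List Bool
  bools = true ∷ false ∷ []
  bits  = false ∷ true ∷ []

  ∑-byEntry : (i : Fin n) (g : Vec Bool n → ℕ) →
    ∑ (allVecs bools n) g ≡ ∑[ x ∈ bits ] ∑[ r ∈ allVecs bools n ] indicator (not (lookup r i)) * g (r [ i ]≔ x)
  ∑-byEntry {suc n} zero g = begin
    ∑ (allVecs bools (suc n)) g      ≡⟨ ∑-allVecs-suc bools n g ⟩
    gWith true + (gWith false + 0)   ≡⟨ swap (gWith true) (gWith false) ⟩
    gWith false + (gWith true + 0)   ≡⟨ sym (cong₂ (λ p q → p + (q + 0)) (clear false) (clear true)) ⟩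
    ∑[ x ∈ bits ] ∑[ r ∈ allVecs bools (suc n) ] indicator (not (lookup r zero)) * g (r [ zero ]≔ x) ∎
    where
    open ≡-Reasoning
    gWith : Bool → ℕ
    gWith x = ∑[ v ∈ allVecs bools n ] g (x ∷ v)
    swap : ∀ a b → a + (b + 0) ≡ b + (a + 0)
    swap = ℕ-Solver.solve-∀
    clear : ∀ x → ∑[ r ∈ allVecs bools (suc n) ] indicator (not (lookup r zero)) * g (r [ zero ]≔ x) ≡ gWith x
    clear x = trans (∑-allVecs-suc bools n _) (cong₂ _+_ (∑-zero (allVecs bools n))
      (trans (ℕₚ.+-identityʳ _) (∑-cong (allVecs bools n) (λ v → ℕₚ.+-identityʳ (g (x ∷ v))))))
  ∑-byEntry {suc n} (suc i) g = begin
    ∑ (allVecs bools (suc n)) g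
      ≡⟨ ∑-allVecs-suc bools n g ⟩
    ∑[ y ∈ bools ] ∑[ v ∈ allVecs bools n ] g (y ∷ v)
      ≡⟨ ∑-cong bools (λ y → ∑-byEntry i (g ∘ (y ∷_))) ⟩
    ∑[ y ∈ bools ] ∑[ x ∈ bits ] ∑[ v ∈ allVecs bools n ] indicator (not (lookup v i)) * g (y ∷ (v [ i ]≔ x))
      ≡⟨ ∑-comm bools bits (λ y x → ∑[ v ∈ allVecs bools n ] indicator (not (lookup v i)) * g (y ∷ (v [ i ]≔ x))) ⟩
    ∑[ x ∈ bits ] ∑[ y ∈ bools ] ∑[ v ∈ allVecs bools n ] indicator (not (lookup v i)) * g (y ∷ (v [ i ]≔ x))
      ≡⟨ ∑-cong bits (λ x → sym (∑-allVecs-suc bools n (λ r → indicator (not (lookup r (suc i))) * g (r [ suc i ]≔ x)))) ⟩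
    ∑[ x ∈ bits ] ∑[ r ∈ allVecs bools (suc n) ] indicator (not (lookup r (suc i))) * g (r [ suc i ]≔ x) ∎
    where open ≡-Reasoning

  module _ {N : ℕ} (i : Fin N) where

    setColumn : {m : ℕ} → Vec (Vec Bool N) m → Vec Bool m → Vec (Vec Bool N) m
    setColumn = Vec.zipWith (λ r x → r [ i ]≔ x)

    emptyColumn : {m : ℕ} → Vec (Vec Bool N) m → ℕ
    emptyColumn []      = 1
    emptyColumn (r ∷ M) = indicator (not (lookup r i)) * emptyColumn M

    emptyColumn-view : {m : ℕ} (M : Vec (Vec Bool N) m) →
      (emptyColumn M ≡ 1 × (∀ u → lookup (lookup M u) i ≡ false)) ⊎
      (emptyColumn M ≡ 0 × ∃ λ u → lookup (lookup M u) i ≡ true)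
    emptyColumn-view []      = inj₁ (refl , λ ())
    emptyColumn-view (r ∷ M) with lookup r i in rᵢ | emptyColumn-view M
    ... | true  | _                = inj₂ (refl , zero , rᵢ)
    ... | false | inj₁ (e , empty) = inj₁ (trans (ℕₚ.+-identityʳ _) e , λ { zero → rᵢ ; (suc u) → empty u })
    ... | false | inj₂ (e , u , h) = inj₂ (trans (ℕₚ.+-identityʳ _) e , suc u , h)

    ∑-byColumn : (m : ℕ) (F : Vec (Vec Bool N) m → ℕ) →
      ∑ (allVecs (allVecs bools N) m) F ≡
      ∑[ σ ∈ allVecs bits m ] ∑[ M ∈ allVecs (allVecs bools N) m ] emptyColumn M * F (setColumn M σ)
    ∑-byColumn zero    F = cong (_+ 0) (sym (trans (ℕₚ.+-identityʳ _) (ℕₚ.+-identityʳ _)))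
    ∑-byColumn (suc m) F = begin
      ∑ (allVecs R (suc m)) F
        ≡⟨ ∑-allVecs-suc R m F ⟩
      ∑[ r ∈ R ] ∑[ M ∈ allVecs R m ] F (r ∷ M)
        ≡⟨ ∑-cong R (λ r → ∑-byColumn m (F ∘ (r ∷_))) ⟩
      ∑ R H
        ≡⟨ ∑-byEntry i H ⟩
      ∑[ x ∈ bits ] ∑[ r ∈ R ] indicator (not (lookup r i)) * H (r [ i ]≔ x)
        ≡⟨ ∑-cong bits pushIn ⟩
      ∑[ x ∈ bits ] ∑[ σ ∈ allVecs bits m ] ∑[ M ∈ allVecs R (suc m) ] emptyColumn M * F (setColumn M (x ∷ σ))
        ≡⟨ sym (∑-allVecs-suc bits m _) ⟩
      ∑[ σ ∈ allVecs bits (suc m) ] ∑[ M ∈ allVecs R (suc m) ] emptyColumn M * F (setColumn M σ) ∎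
      where
      open ≡-Reasoning
      R = allVecs bools N
      H : Vec Bool N → ℕ
      H r = ∑[ σ ∈ allVecs bits m ] ∑[ M ∈ allVecs R m ] emptyColumn M * F (r ∷ setColumn M σ)
      pushIn : ∀ x → ∑[ r ∈ R ] indicator (not (lookup r i)) * H (r [ i ]≔ x) ≡
                     ∑[ σ ∈ allVecs bits m ] ∑[ M ∈ allVecs R (suc m) ] emptyColumn M * F (setColumn M (x ∷ σ))
      pushIn x = trans (∑-cong R distribute) (trans (∑-comm R (allVecs bits m) _)
                   (∑-cong (allVecs bits m) (λ σ → sym (∑-allVecs-suc R m _))))
        where
        distribute : ∀ r → indicator (not (lookup r i)) * H (r [ i ]≔ x) ≡
          ∑[ σ ∈ allVecs bits m ] ∑[ M ∈ allVecs R m ]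
            (indicator (not (lookup r i)) * emptyColumn M) * F ((r [ i ]≔ x) ∷ setColumn M σ)
        distribute r = let c = indicator (not (lookup r i)) in
          trans (*-distribˡ-∑ (allVecs bits m) c _) (∑-cong (allVecs bits m) (λ σ →
            trans (*-distribˡ-∑ (allVecs R m) c _) (∑-cong (allVecs R m) (λ M →
              sym (ℕₚ.*-assoc c (emptyColumn M) _)))))

    edge-setColumn : (M : Digraph N) (σ : Vec Bool N) (u : Fin N) → edge (setColumn M σ) u i ≡ lookup σ u
    edge-setColumn M σ u =
      trans (cong (λ r → lookup r i) (lookup-zipWith _ u M σ)) (lookup∘update i (lookup M u) (lookup σ u))

    edge-setColumn-≢ : (M : Digraph N) (σ : Vec Bool N) (u v : Fin N) → v ≢ i → edge (setColumn M σ) u v ≡ edge M u v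
    edge-setColumn-≢ M σ u v v≢i =
      trans (cong (λ r → lookup r v) (lookup-zipWith _ u M σ)) (lookup∘update′ v≢i (lookup M u) (lookup σ u))

  module _ {N : ℕ} (i : Fin N) {c c′ b : Fin N → ℤ} {k : ℤ}
           (cᵢ≡0 : c i ≡ + 0) (c′ᵢ≡k : c′ i ≡ k) (c′≗c : ∀ v → v ≢ i → c′ v ≡ c v) where

    private
      HasDegrees-setColumn : (M : Digraph N) (σ : Vec Bool N) → (∀ u → edge M u i ≡ false) →
        let s = lookup (Vec.map toℤ σ) in
        HasDegrees c′ b (setColumn i M σ) ⇔ (sumZ s ≡ k × HasDegrees c (b -ᵛ s) M)
      HasDegrees-setColumn M σ empty = mk⇔ remove insert
        where
        open ≡-Reasoning
        M′ = setColumn i M σ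
        s = lookup (Vec.map toℤ σ)
        indeg-i : indeg M′ i ≡ countF (lookup σ)
        indeg-i = countF-cong (edge-setColumn i M σ)
        indeg-≢ : ∀ v → v ≢ i → indeg M′ v ≡ indeg M v
        indeg-≢ v v≢i = countF-cong (λ u → edge-setColumn-≢ i M σ u v v≢i)
        indeg-M-i : indeg M i ≡ 0
        indeg-M-i = trans (countF-cong empty) (countF-false N)
        outdeg-M′ : ∀ u → outdeg M′ u ≡ indicator (lookup σ u) + outdeg M u
        outdeg-M′ u = trans (countF-update i (edge M u) (edge M′ u) (empty u) (edge-setColumn-≢ i M σ u))
                            (cong (λ x → indicator x + outdeg M u) (edge-setColumn i M σ u))
        outdeg⇔ : ∀ u → (+ outdeg M′ u ≡ b u) ⇔ (+ outdeg M u ≡ (b -ᵛ s) u)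
        outdeg⇔ u = mk⇔
          (λ e → trans (to (+≡⇔≡- _ _ (b u)) (trans (cong +_ (sym (outdeg-M′ u))) e)) (cong (ℤ._-_ (b u)) (sym sᵤ)))
          (λ e → trans (cong +_ (outdeg-M′ u)) (from (+≡⇔≡- _ _ (b u)) (trans e (cong (ℤ._-_ (b u)) sᵤ))))
          where
          sᵤ : s u ≡ toℤ (lookup σ u)
          sᵤ = lookup-map u toℤ σ
        remove : HasDegrees c′ b M′ → sumZ s ≡ k × HasDegrees c (b -ᵛ s) M
        remove (in′ , out′) = Σs≡k , inM , (λ u → to (outdeg⇔ u) (out′ u))
          where
          Σs≡k : sumZ s ≡ k
          Σs≡k = begin
            sumZ s             ≡⟨ sumZ-map-toℤ σ ⟩
            + countF (lookup σ) ≡⟨ cong +_ (sym indeg-i) ⟩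
            + indeg M′ i       ≡⟨ in′ i ⟩
            c′ i               ≡⟨ c′ᵢ≡k ⟩
            k                  ∎
          inM : ∀ v → + indeg M v ≡ c v
          inM v with v Fin.≟ i
          ... | yes refl = trans (cong +_ indeg-M-i) (sym cᵢ≡0)
          ... | no v≢i   = trans (cong +_ (sym (indeg-≢ v v≢i))) (trans (in′ v) (c′≗c v v≢i))
        insert : sumZ s ≡ k × HasDegrees c (b -ᵛ s) M → HasDegrees c′ b M′
        insert (Σs≡k , inM , outM) = in′ , (λ u → from (outdeg⇔ u) (outM u))
          where
          in′ : ∀ v → + indeg M′ v ≡ c′ v
          in′ v with v Fin.≟ i
          ... | yes refl = begin
            + indeg M′ i       ≡⟨ cong +_ indeg-i ⟩
            + countF (lookup σ) ≡⟨ sym (sumZ-map-toℤ σ) ⟩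
            sumZ s             ≡⟨ Σs≡k ⟩
            k                  ≡⟨ sym c′ᵢ≡k ⟩
            c′ i               ∎
          ... | no v≢i = trans (cong +_ (indeg-≢ v v≢i)) (trans (inM v) (sym (c′≗c v v≢i)))

      summand-empty : (σ : Vec Bool N) (M : Digraph N) → (∀ u → edge M u i ≡ false) →
        let s = lookup (Vec.map toℤ σ) in
        (if ⌊ sumZ s ℤ.≟ k ⌋ then indicator (realizes c (b -ᵛ s) M) else 0) ≡ indicator (realizes c′ b (setColumn i M σ))
      summand-empty σ M empty = trans (if-indicator d r) (cong indicator (T-injective (mk⇔
        (λ t → let (t-d , t-r) = to (T-∧ {d} {r}) t in
               from (T-realizes c′ b (setColumn i M σ)) (from equiv (toWitness t-d , to (T-realizes c (b -ᵛ s) M) t-r)))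
        (λ t → let (Σs≡k , h) = to equiv (to (T-realizes c′ b (setColumn i M σ)) t) in
               from (T-∧ {d} {r}) (fromWitness Σs≡k , from (T-realizes c (b -ᵛ s) M) h)))))
        where
        s = lookup (Vec.map toℤ σ)
        d = ⌊ sumZ s ℤ.≟ k ⌋
        r = realizes c (b -ᵛ s) M
        equiv = HasDegrees-setColumn M σ empty

      summand-nonempty : (σ : Vec Bool N) (M : Digraph N) (u : Fin N) → edge M u i ≡ true →
        let s = lookup (Vec.map toℤ σ) in
        (if ⌊ sumZ s ℤ.≟ k ⌋ then indicator (realizes c (b -ᵛ s) M) else 0) ≡ 0
      summand-nonempty σ M u edgeᵤᵢ =
        trans (if-indicator d r) (cong indicator (trans (cong (d ∧_) r≡false) (∧-zeroʳ d)))
        where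
        s = lookup (Vec.map toℤ σ)
        d = ⌊ sumZ s ℤ.≟ k ⌋
        r = realizes c (b -ᵛ s) M
        r≡false : r ≡ false
        r≡false = T-injective (mk⇔ (λ t → ⊥-elim (countF≢0 (λ w → edge M w i) u edgeᵤᵢ
          (ℤₚ.+-injective (trans (proj₁ (to (T-realizes c (b -ᵛ s) M) t) i) cᵢ≡0)))) λ ())

    G-byColumn : sumOverS (+ 0 ∷ + 1 ∷ []) (λ s → ⌊ sumZ s ℤ.≟ k ⌋) c b ≡ G c′ b
    G-byColumn = begin
      sumOverS (+ 0 ∷ + 1 ∷ []) (λ s → ⌊ sumZ s ℤ.≟ k ⌋) c b
        ≡⟨ ∑-allVecs-map toℤ bits N _ ⟩
      ∑[ σ ∈ allVecs bits N ] (if ⌊ sumZ (s σ) ℤ.≟ k ⌋ then G c (b -ᵛ s σ) else 0)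
        ≡⟨ ∑-cong (allVecs bits N) (λ σ → trans (∑-if _ (allDigraphs N) _) (∑-cong (allDigraphs N) (summand σ))) ⟩
      ∑[ σ ∈ allVecs bits N ] ∑[ M ∈ allDigraphs N ] emptyColumn i M * indicator (realizes c′ b (setColumn i M σ))
        ≡⟨ sym (∑-byColumn i N (indicator ∘ realizes c′ b)) ⟩
      G c′ b ∎
      where
      open ≡-Reasoning
      s : Vec Bool N → Fin N → ℤ
      s σ = lookup (Vec.map toℤ σ)
      summand : ∀ σ M → (if ⌊ sumZ (s σ) ℤ.≟ k ⌋ then indicator (realizes c (b -ᵛ s σ) M) else 0) ≡
                        emptyColumn i M * indicator (realizes c′ b (setColumn i M σ))
      summand σ M with emptyColumn-view i M
      ... | inj₁ (e≡1 , empty)     rewrite e≡1 = trans (summand-empty σ M empty) (sym (ℕₚ.+-identityʳ _))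
      ... | inj₂ (e≡0 , u , edgeᵤᵢ) rewrite e≡0 = summand-nonempty σ M u edgeᵤᵢ

  -- Double counting vectors with entries in {0, 1, 2}

  binary ternary : List ℤ
  binary  = + 0 ∷ + 1 ∷ []
  ternary = + 0 ∷ + 1 ∷ + 2 ∷ []

  binarySum : (n : ℕ) → ℤ → (Vec ℤ n → ℕ) → ℕ
  binarySum n k h = ∑[ s ∈ allVecs binary n ] (if ⌊ sumZ (lookup s) ℤ.≟ k ⌋ then h s else 0)

  occurrences : ℤ → Vec ℤ n → ℕ
  occurrences x s = countF (λ q → ⌊ lookup s q ℤ.≟ x ⌋)

  ternarySum : (n t : ℕ) → ℤ → (Vec ℤ n → ℕ) → ℕ
  ternarySum n t m h = ∑[ s ∈ allVecs ternary n ]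
    (if ⌊ occurrences (+ 2) s ℕ.≟ t ⌋ ∧ ⌊ + occurrences (+ 1) s ℤ.≟ m ⌋ then h s else 0)

  occurrences-∷ : (x y : ℤ) (s : Vec ℤ n) → occurrences x (y ∷ s) ≡ indicator ⌊ y ℤ.≟ x ⌋ + occurrences x s
  occurrences-∷ x y s = countF-suc (λ q → ⌊ lookup (y ∷ s) q ℤ.≟ x ⌋)

  binarySum-suc : (k : ℤ) (h : Vec ℤ (suc n) → ℕ) →
    binarySum (suc n) k h ≡ binarySum n k (h ∘ (+ 0 ∷_)) + binarySum n (k ℤ.- + 1) (h ∘ (+ 1 ∷_))
  binarySum-suc {n} k h =
    trans (∑-allVecs-suc binary n _)
          (cong₂ _+_ (∑-cong V (λ v → if-cong (lead₀ v)))
                     (trans (ℕₚ.+-identityʳ _) (∑-cong V (λ v → if-cong (lead₁ v)))))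
    where
    V = allVecs binary n
    lead₀ : (v : Vec ℤ n) → ⌊ sumZ (lookup (+ 0 ∷ v)) ℤ.≟ k ⌋ ≡ ⌊ sumZ (lookup v) ℤ.≟ k ⌋
    lead₀ v = cong (λ z → ⌊ z ℤ.≟ k ⌋) (trans (sumZ-suc (lookup (+ 0 ∷ v))) (ℤₚ.+-identityˡ _))
    lead₁ : (v : Vec ℤ n) → ⌊ sumZ (lookup (+ 1 ∷ v)) ℤ.≟ k ⌋ ≡ ⌊ sumZ (lookup v) ℤ.≟ k ℤ.- + 1 ⌋
    lead₁ v = trans (cong (λ z → ⌊ z ℤ.≟ k ⌋) (sumZ-suc (lookup (+ 1 ∷ v)))) (⌊+≟⌋-shift (+ 1) _ k)

  ternarySum-suc : (t : ℕ) (m : ℤ) (h : Vec ℤ (suc n) → ℕ) →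
    ternarySum (suc n) t m h ≡
      ternarySum n t m (h ∘ (+ 0 ∷_)) + (ternarySum n t (m ℤ.- + 1) (h ∘ (+ 1 ∷_)) +
      (∑[ v ∈ allVecs ternary n ]
        (if ⌊ suc (occurrences (+ 2) v) ℕ.≟ t ⌋ ∧ ⌊ + occurrences (+ 1) v ℤ.≟ m ⌋ then h (+ 2 ∷ v) else 0)))
  ternarySum-suc {n} t m h =
    trans (∑-allVecs-suc ternary n _)
          (cong₂ _+_ (∑-cong V (λ v → if-cong (lead (+ 0) v)))
                     (cong₂ _+_ (∑-cong V (λ v → if-cong (trans (lead (+ 1) v) (cong (⌊ occurrences (+ 2) v ℕ.≟ t ⌋ ∧_) (⌊+≟⌋-shift (+ 1) (+ occurrences (+ 1) v) m)))))
                                (trans (ℕₚ.+-identityʳ _) (∑-cong V (λ v → if-cong (lead (+ 2) v))))))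
    where
    V = allVecs ternary n
    lead : (y : ℤ) (v : Vec ℤ n) → (⌊ occurrences (+ 2) (y ∷ v) ℕ.≟ t ⌋ ∧ ⌊ + occurrences (+ 1) (y ∷ v) ℤ.≟ m ⌋) ≡
                   (⌊ indicator ⌊ y ℤ.≟ + 2 ⌋ + occurrences (+ 2) v ℕ.≟ t ⌋ ∧
                    ⌊ + (indicator ⌊ y ℤ.≟ + 1 ⌋ + occurrences (+ 1) v) ℤ.≟ m ⌋)
    lead y v = cong₂ _∧_ (cong (λ z → ⌊ z ℕ.≟ t ⌋) (occurrences-∷ (+ 2) y v))
                         (cong (λ z → ⌊ + z ℤ.≟ m ⌋) (occurrences-∷ (+ 1) y v))

  ternarySum-suc-zero : (m : ℤ) (h : Vec ℤ (suc n) → ℕ) →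
    ternarySum (suc n) 0 m h ≡ ternarySum n 0 m (h ∘ (+ 0 ∷_)) + ternarySum n 0 (m ℤ.- + 1) (h ∘ (+ 1 ∷_))
  ternarySum-suc-zero {n} m h =
    trans (ternarySum-suc 0 m h)
          (cong (_+_ (ternarySum n 0 m (h ∘ (+ 0 ∷_))))
                (trans (cong (_+_ (ternarySum n 0 (m ℤ.- + 1) (h ∘ (+ 1 ∷_)))) (∑-zero (allVecs ternary n)))
                       (ℕₚ.+-identityʳ _)))

  ternarySum-suc-suc : (t : ℕ) (m : ℤ) (h : Vec ℤ (suc n) → ℕ) →
    ternarySum (suc n) (suc t) m h ≡
      ternarySum n (suc t) m (h ∘ (+ 0 ∷_)) + (ternarySum n (suc t) (m ℤ.- + 1) (h ∘ (+ 1 ∷_)) + ternarySum n t m (h ∘ (+ 2 ∷_)))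
  ternarySum-suc-suc {n} t m h =
    trans (ternarySum-suc (suc t) m h)
          (cong (_+_ (ternarySum n (suc t) m (h ∘ (+ 0 ∷_)))) (cong (_+_ (ternarySum n (suc t) (m ℤ.- + 1) (h ∘ (+ 1 ∷_))))
                (∑-cong (allVecs ternary n) (λ v → if-cong (cong (_∧ ⌊ + occurrences (+ 1) v ℤ.≟ m ⌋)
                  (⌊⌋-cong (mk⇔ ℕₚ.suc-injective (cong suc)) (suc (occurrences (+ 2) v) ℕ.≟ suc t) (occurrences (+ 2) v ℕ.≟ t)))))))

  ternarySum-zero : (n : ℕ) (m : ℤ) (h : Vec ℤ n → ℕ) → ternarySum n 0 m h ≡ binarySum n m h
  ternarySum-zero zero    m h = refl
  ternarySum-zero (suc n) m h =
    trans (ternarySum-suc-zero m h)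
          (trans (cong₂ _+_ (ternarySum-zero n m _) (ternarySum-zero n (m ℤ.- + 1) _)) (sym (binarySum-suc m h)))

  addUnit : Fin n → Vec ℤ n → Vec ℤ n
  addUnit u s = updateAt s u (λ x → x ℤ.+ + 1)

  addUnitSum : (n : ℕ) → ℤ → (Vec ℤ n → ℕ) → ℕ
  addUnitSum n k h = ∑[ u ∈ allFin n ] binarySum n (k ℤ.- + 1) (h ∘ addUnit u)

  addUnitSum-suc : (k : ℤ) (h : Vec ℤ (suc n) → ℕ) →
    addUnitSum (suc n) k h ≡
      (binarySum n (k ℤ.- + 1) (h ∘ (+ 1 ∷_)) + binarySum n ((k ℤ.- + 1) ℤ.- + 1) (h ∘ (+ 2 ∷_))) +
      (addUnitSum n k (h ∘ (+ 0 ∷_)) + addUnitSum n (k ℤ.- + 1) (h ∘ (+ 1 ∷_)))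
  addUnitSum-suc {n} k h =
    trans (∑-allFin-suc (λ u → binarySum (suc n) (k ℤ.- + 1) (h ∘ addUnit u)))
          (cong₂ _+_ (binarySum-suc (k ℤ.- + 1) (h ∘ addUnit zero))
                     (trans (∑-cong (allFin n) (λ u → binarySum-suc (k ℤ.- + 1) (h ∘ addUnit (suc u))))
                            (∑-distrib-+ (allFin n) _ _)))

  addUnitSum≡ : (n : ℕ) (k : ℤ) (h : Vec ℤ n → ℕ) →
    + addUnitSum n k h ≡ k ℤ.* + binarySum n k h ℤ.+ + ternarySum n 1 (k ℤ.- + 2) h
  addUnitSum≡ zero k h with + 0 ℤ.≟ k
  ... | yes refl = refl
  ... | no _     = sym (trans (ℤₚ.+-identityʳ _) (ℤₚ.*-zeroʳ k))
  addUnitSum≡ (suc n) k h = begin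
    + addUnitSum (suc n) k h
      ≡⟨ cong +_ (addUnitSum-suc k h) ⟩
    + a₁ ℤ.+ + a₂ ℤ.+ (+ addUnitSum n k h₀ ℤ.+ + addUnitSum n (k ℤ.- + 1) h₁)
      ≡⟨ cong₂ (λ x y → + a₁ ℤ.+ + a₂ ℤ.+ (x ℤ.+ y)) (addUnitSum≡ n k h₀) (addUnitSum≡ n (k ℤ.- + 1) h₁) ⟩
    + a₁ ℤ.+ + a₂ ℤ.+ ((k ℤ.* + b₀ ℤ.+ + t₀) ℤ.+ ((k ℤ.- + 1) ℤ.* + a₁ ℤ.+ + t₁))
      ≡⟨ regroup k (+ a₁) (+ a₂) (+ b₀) (+ t₀) (+ t₁) ⟩
    k ℤ.* (+ b₀ ℤ.+ + a₁) ℤ.+ (+ t₀ ℤ.+ (+ t₁ ℤ.+ + a₂))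
      ≡⟨ sym (cong₂ (λ x y → k ℤ.* + x ℤ.+ + y) (binarySum-suc k h) ternary-step) ⟩
    k ℤ.* + binarySum (suc n) k h ℤ.+ + ternarySum (suc n) 1 (k ℤ.- + 2) h ∎
    where
    open ≡-Reasoning
    h₀ h₁ h₂ : Vec ℤ n → ℕ
    h₀ = h ∘ (+ 0 ∷_)
    h₁ = h ∘ (+ 1 ∷_)
    h₂ = h ∘ (+ 2 ∷_)
    a₁ = binarySum n (k ℤ.- + 1) h₁
    a₂ = binarySum n ((k ℤ.- + 1) ℤ.- + 1) h₂
    b₀ = binarySum n k h₀
    t₀ = ternarySum n 1 (k ℤ.- + 2) h₀
    t₁ = ternarySum n 1 ((k ℤ.- + 1) ℤ.- + 2) h₁
    regroup : ∀ k a₁ a₂ b₀ t₀ t₁ →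
      a₁ ℤ.+ a₂ ℤ.+ ((k ℤ.* b₀ ℤ.+ t₀) ℤ.+ ((k ℤ.- + 1) ℤ.* a₁ ℤ.+ t₁)) ≡ k ℤ.* (b₀ ℤ.+ a₁) ℤ.+ (t₀ ℤ.+ (t₁ ℤ.+ a₂))
    regroup = solve-∀
    shift₁ : ∀ k → (k ℤ.- + 2) ℤ.- + 1 ≡ (k ℤ.- + 1) ℤ.- + 2
    shift₁ = solve-∀
    shift₂ : ∀ k → k ℤ.- + 2 ≡ (k ℤ.- + 1) ℤ.- + 1
    shift₂ = solve-∀
    ternary-step : ternarySum (suc n) 1 (k ℤ.- + 2) h ≡ t₀ + (t₁ + a₂)
    ternary-step =
      trans (ternarySum-suc-suc 0 (k ℤ.- + 2) h)
            (cong₂ (λ x y → t₀ + (x + y)) (cong (λ m → ternarySum n 1 m h₁) (shift₁ k))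
                                          (trans (ternarySum-zero n _ h₂) (cong (λ m → binarySum n m h₂) (shift₂ k))))

open Counting
open import Data.Integer using (ℤ; +_; _+_; _*_; _-_; _≤_)

unit-same : {N : ℕ} (i : Fin N) → unit i i ≡ + 1
unit-same i with i Fin.≟ i
... | yes _   = refl
... | no i≢i = ⊥-elim (i≢i refl)

unit-≢ : {N : ℕ} {i v : Fin N} → i ≢ v → unit i v ≡ + 0
unit-≢ {i = i} {v} i≢v with i Fin.≟ v
... | yes i≡v = ⊥-elim (i≢v i≡v)
... | no _    = refl

-ᵛ-unit-≢ : {N : ℕ} (x : Fin N → ℤ) {i v : Fin N} → v ≢ i → (x -ᵛ unit i) v ≡ x v
-ᵛ-unit-≢ x v≢i = trans (cong (_-_ (x _)) (unit-≢ (≢-sym v≢i))) (ℤₚ.+-identityʳ _)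

lookup-addUnit : {n : ℕ} (u : Fin n) (s : Vec ℤ n) (v : Fin n) → lookup (addUnit u s) v ≡ lookup s v + unit u v
lookup-addUnit u s v with u Fin.≟ v
... | yes refl = lookup∘updateAt u s
... | no u≢v   = trans (lookup∘updateAt′ v u (≢-sym u≢v) s) (sym (ℤₚ.+-identityʳ _))

module _ {N : ℕ} (a : Fin N → ℤ) {i j : Fin N} where

  shiftA-i : j ≢ i → shiftA a i j i ≡ + 0
  shiftA-i j≢i = trans (cong₂ (λ p q → (a i - a i * p) - q) (unit-same i) (unit-≢ j≢i)) (cancel (a i))
    where
    cancel : ∀ x → (x - x * + 1) - + 0 ≡ + 0
    cancel = solve-∀

  shiftA-≢ : {v : Fin N} → v ≢ i → shiftA a i j v ≡ (a -ᵛ unit j) v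
  shiftA-≢ {v} v≢i = cong (_- unit j v) (trans (cong (λ z → a v - a i * z) (unit-≢ (≢-sym v≢i))) (cancel (a v) (a i)))
    where
    cancel : ∀ x y → x - y * + 0 ≡ x
    cancel = solve-∀

module _ {N : ℕ} (a b : Fin N → ℤ) where

  X0≡G : {i j : Fin N} → i ≢ j → X0 a b i j ≡ G (a -ᵛ unit j) b
  X0≡G {i} {j} i≢j = G-byColumn i (shiftA-i a (≢-sym i≢j)) (-ᵛ-unit-≢ a i≢j) (λ v v≢i → sym (shiftA-≢ a v≢i))

  Q : Fin N → Fin N → ℕ
  Q i j = ∑[ u ∈ allFin N ] G ((a -ᵛ unit i) -ᵛ unit j) (b -ᵛ unit u)

  Q-sym : (i j : Fin N) → Q i j ≡ Q j i
  Q-sym i j = ∑-cong (allFin N) (λ u → G-cong (λ v → swap (a v) (unit i v) (unit j v)) (λ _ → refl))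
    where
    swap : ∀ x p q → (x - p) - q ≡ (x - q) - p
    swap = solve-∀

  Q≡aᵢX0+X1 : {i j : Fin N} → i ≢ j → + Q i j ≡ a i * + X0 a b i j + + X1 a b i j
  Q≡aᵢX0+X1 {i} {j} i≢j = trans (cong +_ (∑-cong (allFin N) removeColumn)) (addUnitSum≡ N (a i) hᵢ)
    where
    hᵢ : Vec ℤ N → ℕ
    hᵢ s = G (shiftA a i j) (b -ᵛ lookup s)
    regroup : ∀ x e s → (x - e) - s ≡ x - (s + e)
    regroup = solve-∀
    removeColumn : ∀ u → G ((a -ᵛ unit i) -ᵛ unit j) (b -ᵛ unit u) ≡ binarySum N (a i - + 1) (hᵢ ∘ addUnit u)
    removeColumn u =
      trans (sym (G-byColumn i (shiftA-i a (≢-sym i≢j))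
                  (trans (-ᵛ-unit-≢ (a -ᵛ unit i) i≢j) (cong (_-_ (a i)) (unit-same i)))
                  (λ v v≢i → trans (cong (_- unit j v) (-ᵛ-unit-≢ a v≢i)) (sym (shiftA-≢ a v≢i)))))
            (∑-cong (allVecs binary N) (λ s → if-cong-then ⌊ sumZ (lookup s) ℤ.≟ a i - + 1 ⌋
              (G-cong {a = shiftA a i j} (λ _ → refl) (λ v →
                trans (regroup (b v) (unit u v) (lookup s v)) (cong (_-_ (b v)) (sym (lookup-addUnit u s v)))))))

-- The hypotheses on degree sums, on aᵢ, aⱼ ≥ 1 and the nonvanishing ones only serve
-- to make the quotients in the informal statement meaningful; the cross-multiplied
-- identity holds without them.
corollary5 : (N : ℕ) (a b : Fin N → ℤ) (i j : Fin N) →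
    sumZ a ≡ sumZ b + + 1 → i ≢ j → + 1 ≤ a i → + 1 ≤ a j →
    G (a -ᵛ unit j) b ≢ 0 → X0 a b i j ≢ 0 → X0 a b j i ≢ 0 →
    + G (a -ᵛ unit i) b * a j * (a i * + X0 a b i j) * (a j * + X0 a b j i + + X1 a b j i)
      ≡ + G (a -ᵛ unit j) b * a i * (a i * + X0 a b i j + + X1 a b i j) * (a j * + X0 a b j i)
corollary5 N a b i j _ i≢j _ _ _ _ _ = begin
  + Gᵢ * a j * (a i * + X0 a b i j) * (a j * + X0 a b j i + + X1 a b j i)
    ≡⟨ cong₂ (λ x y → + Gᵢ * a j * (a i * + x) * y) (X0≡G a b i≢j) (sym (Q≡aᵢX0+X1 a b j≢i)) ⟩
  + Gᵢ * a j * (a i * + Gⱼ) * + Q a b j i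
    ≡⟨ rearrange (+ Gᵢ) (+ Gⱼ) (a i) (a j) (+ Q a b j i) ⟩
  + Gⱼ * a i * + Q a b j i * (a j * + Gᵢ)
    ≡⟨ cong₂ (λ y x → + Gⱼ * a i * y * (a j * + x)) (trans (cong +_ (Q-sym a b j i)) (Q≡aᵢX0+X1 a b i≢j)) (sym (X0≡G a b j≢i)) ⟩
  + Gⱼ * a i * (a i * + X0 a b i j + + X1 a b i j) * (a j * + X0 a b j i) ∎
  where
  open ≡-Reasoning
  Gᵢ = G (a -ᵛ unit i) b
  Gⱼ = G (a -ᵛ unit j) b
  j≢i = ≢-sym i≢j
  rearrange : ∀ gᵢ gⱼ aᵢ aⱼ q → gᵢ * aⱼ * (aᵢ * gⱼ) * q ≡ gⱼ * aᵢ * q * (aⱼ * gᵢ)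
  rearrange = solve-∀
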